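{- Let $n\ge 8$ be even and let $I$ be an independent set in $C_n(1,3)$ containing both an odd number and an even number. Then $|I|\le n/2-3$.
   Context: $C_n(1,3)$ is the simple graph with vertex set $\{1,\dots,n\}$ in which distinct vertices $i,j$ are adjacent iff $i-j\equiv \pm1$ or $\pm 3 \pmod n$. -}

module Defs where

open import Data.Nat using (ℕ; suc; _+_; _∸_; _%_; NonZero)
open import Data.Nat.Divisibility using (_∣_)
open import Data.Fin using (Fin; toℕ)
open import Data.Fin.Subset using (Subset; _∈_)
open import Data.Product using (_×_; ∃-syntax)
open import Data.Sum using (_⊎_)
open import Relation.Binary.PropositionalEquality using (_≡_; _≢_)
open import Relation.Nullary using (¬_)

-- Vertex v : Fin n represents the label  toℕ v + 1  ∈ {1,…,n}.
label : ∀ {n} → Fin n → ℕ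
label v = suc (toℕ v)

-- (i - j) mod n, computed on naturals as (i + n - j) mod n  (labels are ≤ n)
diffMod : (n : ℕ) → .{{NonZero n}} → ℕ → ℕ → ℕ
diffMod n i j = (i + n ∸ j) % n

congDiff : (n : ℕ) → .{{NonZero n}} → ℕ → ℕ → ℕ → Set
congDiff n i j d = diffMod n i j ≡ d % n

Adj : (n : ℕ) → .{{NonZero n}} → Fin n → Fin n → Set
Adj n u v =
  u ≢ v ×
  ( congDiff n (label u) (label v) 1
  ⊎ congDiff n (label u) (label v) (n ∸ 1)
  ⊎ congDiff n (label u) (label v) 3
  ⊎ congDiff n (label u) (label v) (n ∸ 3))

Independent : (n : ℕ) → .{{NonZero n}} → Subset n → Set
Independent n I = ∀ u v → u ∈ I → v ∈ I → ¬ Adj n u v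

Even Odd : ℕ → Set
Even m = 2 ∣ m
Odd m = 2 ∣ suc m

-- Identify a vertex with its position t = label − 1 modulo n and send it to
-- the odd residue t (t odd) or t + 3 (t even), then to the slot ⌊r / 2⌋ of
-- that odd residue r; for even n there are n / 2 slots. On an independent set
-- this is injective: two positions in one slot are equal or differ by 3.
-- As I contains positions of both parities, walking along the even positions
-- from just before an odd member of I to an even member of I finds an even z
-- with z, z + 2, z + 4 ∉ I and z + 6 ∈ I. The slots of z + 3, z + 5, z + 7
-- then receive nothing: their other candidates are z, z + 2, z + 4, and
-- z + 3, z + 5, z + 7 are all adjacent to z + 6. Hence |I| ≤ n / 2 − 3.
module Submission where

open import Defs
open import Data.Nat using (ℕ; zero; suc; pred; _+_; _*_; _∸_; _%_; _/_; _≤_; _<_; z≤n; s≤s; NonZero)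
open import Data.Nat.Properties
open import Data.Nat.DivMod
open import Data.Nat.Divisibility using (_∣_; divides)
open import Data.Fin using (Fin; zero; suc; toℕ; fromℕ<)
open import Data.Fin.Properties using (toℕ-injective; toℕ<n; toℕ-fromℕ<)
import Data.Fin.Properties as Finₚ
open import Data.Fin.Subset using (Subset; _∈_; _∉_; ∣_∣; _-_; ⊤; inside; outside)
open import Data.Fin.Subset.Properties using (x∈p⇒∣p-x∣<∣p∣; x∈p∧x≢y⇒x∈p-y; ∈⊤; ∣⊤∣≡n; _∈?_)
open import Data.Vec using (_∷_; []; here; there)
open import Data.Product using (∃-syntax; _×_; _,_)
open import Data.Sum using (_⊎_; inj₁; inj₂)
open import Relation.Nullary using (¬_; yes; no; contradiction)
open import Relation.Unary using (Decidable)
open import Relation.Binary.PropositionalEquality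
open import Algebra.Properties.CommutativeSemigroup +-commutativeSemigroup using (x∙yz≈z∙yx)

module _ {k : ℕ} .{{_ : NonZero k}} where

  +-congˡ-% : ∀ c {a b} → a % k ≡ b % k → (c + a) % k ≡ (c + b) % k
  +-congˡ-% c {a} {b} eq = begin
    (c + a) % k           ≡⟨ %-distribˡ-+ c a k ⟩
    (c % k + a % k) % k   ≡⟨ cong (λ r → (c % k + r) % k) eq ⟩
    (c % k + b % k) % k   ≡⟨ %-distribˡ-+ c b k ⟨
    (c + b) % k           ∎
    where open ≡-Reasoning

  -- Adding c * (k − 1) turns c + a into a + c * k.
  +-cancelˡ-% : ∀ c {a b} → (c + a) % k ≡ (c + b) % k → a % k ≡ b % k
  +-cancelˡ-% c {a} {b} eq = begin
    a % k                       ≡⟨ [m+kn]%n≡m%n a c k ⟨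
    (a + c * k) % k             ≡⟨ %-congˡ (regroup a) ⟩
    (c * pred k + (c + a)) % k  ≡⟨ +-congˡ-% (c * pred k) eq ⟩
    (c * pred k + (c + b)) % k  ≡⟨ %-congˡ (regroup b) ⟨
    (b + c * k) % k             ≡⟨ [m+kn]%n≡m%n b c k ⟩
    b % k                       ∎
    where
    open ≡-Reasoning
    regroup : ∀ x → x + c * k ≡ c * pred k + (c + x)
    regroup x = begin
      x + c * k             ≡⟨ cong (λ l → x + c * l) (suc-pred k) ⟨
      x + c * suc (pred k)  ≡⟨ cong (x +_) (*-suc c (pred k)) ⟩
      x + (c + c * pred k)  ≡⟨ x∙yz≈z∙yx x c (c * pred k) ⟩
      c * pred k + (c + x)  ∎

  congDiff-+ : ∀ d b → congDiff k ((d + b) % k) (b % k) d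
  congDiff-+ d b = +-cancelˡ-% B (begin
    (B + ((d + b) % k + k ∸ B)) % k  ≡⟨ %-congˡ (m+[n∸m]≡n B≤) ⟩
    ((d + b) % k + k) % k            ≡⟨ [m+n]%n≡m%n ((d + b) % k) k ⟩
    (d + b) % k % k                  ≡⟨ m%n%n≡m%n (d + b) k ⟩
    (d + b) % k                      ≡⟨ +-congˡ-% d (m%n%n≡m%n b k) ⟨
    (d + B) % k                      ≡⟨ %-congˡ (+-comm d B) ⟩
    (B + d) % k                      ∎)
    where
    open ≡-Reasoning
    B = b % k
    B≤ : B ≤ (d + b) % k + k
    B≤ = ≤-trans (m%n≤n b k) (m≤n+m k ((d + b) % k))

  [d+b]%k≢b%k : ∀ {d} b → 0 < d → d < k → (d + b) % k ≢ b % k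
  [d+b]%k≢b%k {d} b 0<d d<k eq = <⇒≢ 0<d (sym (begin
    d            ≡⟨ m<n⇒m%n≡m d<k ⟨
    d % k        ≡⟨ +-cancelˡ-% b b+d≡b+0 ⟩
    0 % k        ≡⟨ m<n⇒m%n≡m (≤-<-trans z≤n d<k) ⟩
    0            ∎))
    where
    open ≡-Reasoning
    b+d≡b+0 : (b + d) % k ≡ (b + 0) % k
    b+d≡b+0 = begin
      (b + d) % k  ≡⟨ %-congˡ (+-comm b d) ⟩
      (d + b) % k  ≡⟨ eq ⟩
      b % k        ≡⟨ %-congˡ (+-identityʳ b) ⟨
      (b + 0) % k  ∎

  toℕ-mod : ∀ a → toℕ (a mod k) ≡ a % k
  toℕ-mod a = toℕ-fromℕ< (m%n<n a k)

  mod-cong : ∀ {a b} → a % k ≡ b % k → a mod k ≡ b mod k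
  mod-cong {a} {b} eq = toℕ-injective (trans (toℕ-mod a) (trans eq (sym (toℕ-mod b))))

  mod-injective : ∀ {a b} → a mod k ≡ b mod k → a % k ≡ b % k
  mod-injective {a} {b} eq = trans (sym (toℕ-mod a)) (trans (cong toℕ eq) (toℕ-mod b))

  [d+b]mod≢b-mod : ∀ {d} b → 0 < d → d < k → (d + b) mod k ≢ b mod k
  [d+b]mod≢b-mod b 0<d d<k eq = [d+b]%k≢b%k b 0<d d<k (mod-injective eq)

  congDiff-label : ∀ d b → congDiff k (label ((d + b) mod k)) (label (b mod k)) d
  congDiff-label d b = trans (cong₂ (diffMod k) (toℕ-mod (d + b)) (toℕ-mod b)) (congDiff-+ d b)

  toℕ-mod-inverse : ∀ (x : Fin k) → toℕ x mod k ≡ x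
  toℕ-mod-inverse x = toℕ-injective (trans (toℕ-mod (toℕ x)) (m<n⇒m%n≡m (toℕ<n x)))

  toℕ-%-injective : ∀ {x y : Fin k} → toℕ x % k ≡ toℕ y % k → x ≡ y
  toℕ-%-injective {x} {y} eq = trans (sym (toℕ-mod-inverse x)) (trans (mod-cong eq) (toℕ-mod-inverse y))

data Jump : ℕ → Set where
  jump₁ : Jump 1
  jump₃ : Jump 3

module _ {n : ℕ} .{{_ : NonZero n}} (3<n : 3 < n) where

  Adj-jump : ∀ {d} → Jump d → ∀ b → Adj n ((d + b) mod n) (b mod n)
  Adj-jump jump₁ b = [d+b]mod≢b-mod b (s≤s z≤n) (≤-<-trans (m≤n+m 1 2) 3<n) , inj₁ (congDiff-label 1 b)
  Adj-jump jump₃ b = [d+b]mod≢b-mod b (s≤s z≤n) 3<n , inj₂ (inj₂ (inj₁ (congDiff-label 3 b)))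

∣p∣≤∣q∣-injection : ∀ {a b} {p : Subset a} {q : Subset b} (f : Fin a → Fin b) →
  (∀ {x} → x ∈ p → f x ∈ q) →
  (∀ {x y} → x ∈ p → y ∈ p → f x ≡ f y → x ≡ y) →
  ∣ p ∣ ≤ ∣ q ∣
∣p∣≤∣q∣-injection {p = []} f maps inj = z≤n
∣p∣≤∣q∣-injection {p = outside ∷ p} f maps inj =
  ∣p∣≤∣q∣-injection (λ x → f (suc x)) (λ x∈p → maps (there x∈p))
    (λ x∈p y∈p eq → Finₚ.suc-injective (inj (there x∈p) (there y∈p) eq))
∣p∣≤∣q∣-injection {p = inside ∷ p} {q} f maps inj =
  ≤-trans (s≤s rest) (x∈p⇒∣p-x∣<∣p∣ (maps here))
  where
  rest : ∣ p ∣ ≤ ∣ q - f zero ∣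
  rest = ∣p∣≤∣q∣-injection (λ x → f (suc x))
    (λ x∈p → x∈p∧x≢y⇒x∈p-y (maps (there x∈p)) (λ eq → Finₚ.0≢1+n (inj here (there x∈p) (sym eq))))
    (λ x∈p y∈p eq → Finₚ.suc-injective (inj (there x∈p) (there y∈p) eq))

3+∣⊤-x-y-z∣≤n : ∀ {n} {x y z : Fin n} → y ≢ x → z ≢ x → z ≢ y → 3 + ∣ ⊤ - x - y - z ∣ ≤ n
3+∣⊤-x-y-z∣≤n {n} {x} {y} {z} y≢x z≢x z≢y = begin
  3 + ∣ ⊤ - x - y - z ∣  ≤⟨ s≤s (s≤s (x∈p⇒∣p-x∣<∣p∣ (x∈p∧x≢y⇒x∈p-y (x∈p∧x≢y⇒x∈p-y ∈⊤ z≢x) z≢y))) ⟩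
  2 + ∣ ⊤ - x - y ∣      ≤⟨ s≤s (x∈p⇒∣p-x∣<∣p∣ (x∈p∧x≢y⇒x∈p-y ∈⊤ y≢x)) ⟩
  1 + ∣ ⊤ - x ∣          ≤⟨ x∈p⇒∣p-x∣<∣p∣ (∈⊤ {x = x}) ⟩
  ∣ ⊤ {n} ∣              ≡⟨ ∣⊤∣≡n n ⟩
  n                      ∎
  where open ≤-Reasoning

module _ {P : ℕ → Set} (P? : Decidable P) where

  three-misses-then-hit′ : ∀ l {i} → ¬ P i → ¬ P (1 + i) → ¬ P (2 + i) → P (3 + l + i) →
    ∃[ j ] (¬ P j × ¬ P (1 + j) × ¬ P (2 + j) × P (3 + j))
  three-misses-then-hit′ zero miss₀ miss₁ miss₂ hit = _ , miss₀ , miss₁ , miss₂ , hit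
  three-misses-then-hit′ (suc l) {i} miss₀ miss₁ miss₂ hit with P? (3 + i)
  ... | yes hit₃ = i , miss₀ , miss₁ , miss₂ , hit₃
  ... | no miss₃ =
    three-misses-then-hit′ l miss₁ miss₂ miss₃ (subst P (sym (+-suc (3 + l) i)) hit)

  three-misses-then-hit : ∀ {i h} → i ≤ h → ¬ P i → ¬ P (1 + i) → ¬ P (2 + i) → P h →
    ∃[ j ] (¬ P j × ¬ P (1 + j) × ¬ P (2 + j) × P (3 + j))
  three-misses-then-hit {i} {h} i≤h miss₀ miss₁ miss₂ hit with h ∸ i | m∸n+n≡m i≤h
  ... | 0 | refl = contradiction hit miss₀
  ... | 1 | refl = contradiction hit miss₁
  ... | 2 | refl = contradiction hit miss₂
  ... | suc (suc (suc l)) | refl = three-misses-then-hit′ l miss₀ miss₁ miss₂ hit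

oddRep : ℕ → ℕ
oddRep t with t % 2
... | zero  = 3 + t
... | suc _ = t

oddRep-odd : ∀ t → oddRep t % 2 ≡ 1
oddRep-odd t with t % 2 in t%2 | m%n<n t 2
... | zero | _ = begin
  (3 + t) % 2          ≡⟨ %-distribˡ-+ 3 t 2 ⟩
  (1 + t % 2) % 2      ≡⟨ cong (λ r → (1 + r) % 2) t%2 ⟩
  1                    ∎
  where open ≡-Reasoning
... | suc zero | _ = t%2
... | suc (suc _) | s≤s (s≤s ())

oddRep≡t⊎3+t : ∀ t → oddRep t ≡ t ⊎ oddRep t ≡ 3 + t
oddRep≡t⊎3+t t with t % 2
... | zero  = inj₂ refl
... | suc _ = inj₁ refl

oddRep-residue : ∀ {k} .{{_ : NonZero k}} t c → oddRep t % k ≡ c % k → t % k ≡ c % k ⊎ (3 + t) % k ≡ c % k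
oddRep-residue {k} t c eq with oddRep≡t⊎3+t t
... | inj₁ ρ≡t = inj₁ (trans (cong (_% k) (sym ρ≡t)) eq)
... | inj₂ ρ≡3+t = inj₂ (trans (cong (_% k) (sym ρ≡3+t)) eq)

module _ {n : ℕ} .{{_ : NonZero n}} (2∣n : 2 ∣ n) where

  slot : ℕ → Fin (n / 2)
  slot a = fromℕ< (m<n*o⇒m/o<n (subst (a % n <_) (sym (m/n*n≡m 2∣n)) (m%n<n a n)))

  slot-injective : ∀ {a b} → a % 2 ≡ 1 → b % 2 ≡ 1 → slot a ≡ slot b → a % n ≡ b % n
  slot-injective {a} {b} a-odd b-odd eq = begin
    a % n                      ≡⟨ m≡m%n+[m/n]*n (a % n) 2 ⟩
    a % n % 2 + a % n / 2 * 2  ≡⟨ cong₂ (λ r q → r + q * 2) same-parity same-half ⟩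
    b % n % 2 + b % n / 2 * 2  ≡⟨ m≡m%n+[m/n]*n (b % n) 2 ⟨
    b % n                      ∎
    where
    open ≡-Reasoning
    same-parity : a % n % 2 ≡ b % n % 2
    same-parity = begin
      a % n % 2  ≡⟨ m∣n⇒o%n%m≡o%m 2 n a 2∣n ⟩
      a % 2      ≡⟨ a-odd ⟩
      1          ≡⟨ b-odd ⟨
      b % 2      ≡⟨ m∣n⇒o%n%m≡o%m 2 n b 2∣n ⟨
      b % n % 2  ∎
    same-half : a % n / 2 ≡ b % n / 2
    same-half = trans (sym (toℕ-fromℕ< _)) (trans (cong toℕ eq) (toℕ-fromℕ< _))

module _ {n : ℕ} .{{_ : NonZero n}} (2∣n : 2 ∣ n) (4<n : 4 < n) {I : Subset n} (indep : Independent n I) where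

  jump-∉ : ∀ {d a b} → Jump d → a % n ≡ (d + b) % n → a mod n ∈ I → b mod n ∉ I
  jump-∉ {b = b} j eq a∈I b∈I =
    indep _ _ (subst (_∈ I) (mod-cong eq) a∈I) b∈I (Adj-jump (<⇒≤ 4<n) j b)

  toℕ-mod-∈ : ∀ {x} → x ∈ I → toℕ x mod n ∈ I
  toℕ-mod-∈ {x} = subst (_∈ I) (sym (toℕ-mod-inverse x))

  vertexSlot : Fin n → Fin (n / 2)
  vertexSlot x = slot 2∣n (oddRep (toℕ x))

  vertexSlot-injective : ∀ {x y} → x ∈ I → y ∈ I → vertexSlot x ≡ vertexSlot y → x ≡ y
  vertexSlot-injective {x} {y} x∈I y∈I eq
    with oddRep-residue (toℕ x) _ (slot-injective 2∣n (oddRep-odd (toℕ x)) (oddRep-odd (toℕ y)) eq)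
  ... | inj₁ tx≈ρy with oddRep-residue (toℕ y) _ (sym tx≈ρy)
  ...   | inj₁ ty≈tx = toℕ-%-injective (sym ty≈tx)
  ...   | inj₂ 3+ty≈tx = contradiction (toℕ-mod-∈ y∈I) (jump-∉ jump₃ (sym 3+ty≈tx) (toℕ-mod-∈ x∈I))
  vertexSlot-injective {x} {y} x∈I y∈I eq
    | inj₂ 3+tx≈ρy with oddRep-residue (toℕ y) _ (sym 3+tx≈ρy)
  ...   | inj₁ ty≈3+tx = contradiction (toℕ-mod-∈ x∈I) (jump-∉ jump₃ ty≈3+tx (toℕ-mod-∈ y∈I))
  ...   | inj₂ 3+ty≈3+tx = toℕ-%-injective (sym (+-cancelˡ-% 3 3+ty≈3+tx))

  vertexSlot-hit : ∀ x i → vertexSlot x ≡ slot 2∣n (3 + i * 2) →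
    toℕ x % n ≡ (i * 2) % n ⊎ toℕ x % n ≡ (3 + i * 2) % n
  vertexSlot-hit x i eq
    with oddRep-residue (toℕ x) _ (slot-injective 2∣n (oddRep-odd (toℕ x)) ([m+kn]%n≡m%n 3 i 2) eq)
  ... | inj₁ tx≈3+2i = inj₂ tx≈3+2i
  ... | inj₂ 3+tx≈3+2i = inj₁ (+-cancelˡ-% 3 3+tx≈3+2i)

  EvenOccupied : ℕ → Set
  EvenOccupied j = (j * 2) mod n ∈ I

  3+∣I∣≤n/2-from-gap : ∀ j → ¬ EvenOccupied j → ¬ EvenOccupied (1 + j) → ¬ EvenOccupied (2 + j) →
    EvenOccupied (3 + j) → 3 + ∣ I ∣ ≤ n / 2
  3+∣I∣≤n/2-from-gap j miss₀ miss₁ miss₂ hit = begin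
    3 + ∣ I ∣                ≤⟨ +-monoʳ-≤ 3 (∣p∣≤∣q∣-injection vertexSlot avoids vertexSlot-injective) ⟩
    3 + ∣ ⊤ - s₃ - s₅ - s₇ ∣  ≤⟨ 3+∣⊤-x-y-z∣≤n s₅≢s₃ s₇≢s₃ s₇≢s₅ ⟩
    n / 2                    ∎
    where
    open ≤-Reasoning
    s₃ s₅ s₇ : Fin (n / 2)
    s₃ = slot 2∣n (3 + j * 2)
    s₅ = slot 2∣n (5 + j * 2)
    s₇ = slot 2∣n (7 + j * 2)

    2<n : 2 < n
    2<n = ≤-<-trans (m≤n+m 2 2) 4<n

    s₅≢s₃ : s₅ ≢ s₃
    s₅≢s₃ eq = [d+b]%k≢b%k (3 + j * 2) (s≤s z≤n) 2<n
      (slot-injective 2∣n ([m+kn]%n≡m%n 5 j 2) ([m+kn]%n≡m%n 3 j 2) eq)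
    s₇≢s₃ : s₇ ≢ s₃
    s₇≢s₃ eq = [d+b]%k≢b%k (3 + j * 2) (s≤s z≤n) 4<n
      (slot-injective 2∣n ([m+kn]%n≡m%n 7 j 2) ([m+kn]%n≡m%n 3 j 2) eq)
    s₇≢s₅ : s₇ ≢ s₅
    s₇≢s₅ eq = [d+b]%k≢b%k (5 + j * 2) (s≤s z≤n) 2<n
      (slot-injective 2∣n ([m+kn]%n≡m%n 7 j 2) ([m+kn]%n≡m%n 5 j 2) eq)

    avoid₃ : ∀ {x} → x ∈ I → vertexSlot x ≢ s₃
    avoid₃ {x} x∈I eq with vertexSlot-hit x j eq
    ... | inj₁ tx≈2j = miss₀ (subst (_∈ I) (mod-cong tx≈2j) (toℕ-mod-∈ x∈I))
    ... | inj₂ tx≈3+2j = jump-∉ jump₃ (+-congˡ-% 3 (sym tx≈3+2j)) hit (toℕ-mod-∈ x∈I)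

    avoid₅ : ∀ {x} → x ∈ I → vertexSlot x ≢ s₅
    avoid₅ {x} x∈I eq with vertexSlot-hit x (1 + j) eq
    ... | inj₁ tx≈2+2j = miss₁ (subst (_∈ I) (mod-cong tx≈2+2j) (toℕ-mod-∈ x∈I))
    ... | inj₂ tx≈5+2j = jump-∉ jump₁ (+-congˡ-% 1 (sym tx≈5+2j)) hit (toℕ-mod-∈ x∈I)

    avoid₇ : ∀ {x} → x ∈ I → vertexSlot x ≢ s₇
    avoid₇ {x} x∈I eq with vertexSlot-hit x (2 + j) eq
    ... | inj₁ tx≈4+2j = miss₂ (subst (_∈ I) (mod-cong tx≈4+2j) (toℕ-mod-∈ x∈I))
    ... | inj₂ tx≈7+2j = jump-∉ jump₁ tx≈7+2j (toℕ-mod-∈ x∈I) hit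

    avoids : ∀ {x} → x ∈ I → vertexSlot x ∈ ⊤ - s₃ - s₅ - s₇
    avoids x∈I = x∈p∧x≢y⇒x∈p-y (x∈p∧x≢y⇒x∈p-y (x∈p∧x≢y⇒x∈p-y ∈⊤ (avoid₃ x∈I)) (avoid₅ x∈I)) (avoid₇ x∈I)

  even-gap : ∀ {x y} → x ∈ I → Odd (label x) → y ∈ I → Even (label y) →
    ∃[ j ] (¬ EvenOccupied j × ¬ EvenOccupied (1 + j) × ¬ EvenOccupied (2 + j) × EvenOccupied (3 + j))
  even-gap {x} {y} x∈I (divides (suc p) 2+tx≡) y∈I (divides (suc j₀) 1+ty≡) =
    three-misses-then-hit (λ j → (j * 2) mod n ∈? I) j₀≤p+n miss₀ miss₁ miss₂ hit
    where
    tx≡ : toℕ x ≡ p * 2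
    tx≡ = suc-injective (suc-injective 2+tx≡)
    ty≡ : toℕ y ≡ 1 + j₀ * 2
    ty≡ = suc-injective 1+ty≡

    y-occupied : (1 + j₀ * 2) mod n ∈ I
    y-occupied = subst (λ t → t mod n ∈ I) ty≡ (toℕ-mod-∈ y∈I)

    miss₀ : ¬ EvenOccupied j₀
    miss₀ = jump-∉ jump₁ refl y-occupied
    miss₁ : ¬ EvenOccupied (1 + j₀)
    miss₁ occupied = jump-∉ jump₁ refl occupied y-occupied
    miss₂ : ¬ EvenOccupied (2 + j₀)
    miss₂ occupied = jump-∉ jump₃ refl occupied y-occupied

    hit : EvenOccupied (p + n)
    hit = subst (_∈ I) (mod-cong (begin
      toℕ x % n            ≡⟨ cong (_% n) tx≡ ⟩
      (p * 2) % n          ≡⟨ [m+kn]%n≡m%n (p * 2) 2 n ⟨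
      (p * 2 + 2 * n) % n  ≡⟨ %-congˡ (cong (p * 2 +_) (*-comm 2 n)) ⟩
      (p * 2 + n * 2) % n  ≡⟨ %-congˡ (*-distribʳ-+ 2 p n) ⟨
      ((p + n) * 2) % n    ∎)) (toℕ-mod-∈ x∈I)
      where open ≡-Reasoning

    j₀≤p+n : j₀ ≤ p + n
    j₀≤p+n = begin
      j₀           ≤⟨ m≤m*n j₀ 2 ⟩
      j₀ * 2       <⟨ n<1+n (j₀ * 2) ⟩
      1 + j₀ * 2   ≡⟨ ty≡ ⟨
      toℕ y        <⟨ toℕ<n y ⟩
      n            ≤⟨ m≤n+m n p ⟩
      p + n        ∎
      where open ≤-Reasoning
  even-gap x∈I (divides zero ()) _ _
  even-gap _ _ _ (divides zero ())

  3+∣I∣≤n/2 : ∀ {x y} → x ∈ I → Odd (label x) → y ∈ I → Even (label y) → 3 + ∣ I ∣ ≤ n / 2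
  3+∣I∣≤n/2 x∈I x-odd y∈I y-even with even-gap x∈I x-odd y∈I y-even
  ... | j , miss₀ , miss₁ , miss₂ , hit = 3+∣I∣≤n/2-from-gap j miss₀ miss₁ miss₂ hit

lemma2p6 : (n : ℕ) → .{{_ : NonZero n}} → 8 ≤ n → 2 ∣ n → (I : Subset n) →
    Independent n I →
    (∃[ u ] (u ∈ I × Odd (label u))) →
    (∃[ v ] (v ∈ I × Even (label v))) →
    ∣ I ∣ ≤ n / 2 ∸ 3
lemma2p6 n 8≤n 2∣n I indep (x , x∈I , x-odd) (y , y∈I , y-even) =
  m+n≤o⇒m≤o∸n ∣ I ∣ (subst (_≤ n / 2) (+-comm 3 ∣ I ∣) (3+∣I∣≤n/2 2∣n 4<n indep x∈I x-odd y∈I y-even))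
  where
  4<n : 4 < n
  4<n = ≤-trans (m≤n+m 5 3) 8≤n
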